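{- Run \textsc{Threshold-Swapping}$(k,\varepsilon,\tau)$ on any stream, and let $S$ and $S'$ be its final sets. Let $K=S'\setminus S$ and extend $w$ additively to sets, $w(X)=\sum_{x\in X}w(x)$. Then (i) $w(K)\le w(S)$; (ii) $w(S)\le f(S)$; (iii) $f(S')=w(S')$.
   Context: $f:2^V\to\mathbb{R}_{\ge0}$ is monotone, normalized ($f(\emptyset)=0$) and submodular; $\mathcal{M}$ is a matroid on $V$ of rank $k$; $\varepsilon,\tau\ge0$; $f(X\mid Y)=f(X\cup Y)-f(Y)$. Algorithm \textsc{Threshold-Swapping}$(k,\varepsilon,\tau)$: initialize $S\gets\emptyset$, $S'\gets\emptyset$. For each arriving element $e$: set $w(e)\gets f(e\mid S')$ (fixed forever). If $w(e)<\frac{\varepsilon}{k}\tau$, ignore $e$. Otherwise, if $S+e\in\mathcal{M}$, set $S\gets S+e$, $S'\gets S'+e$; else let $s_e\in\arg\min\{w(y):y\in S,\ S-y+e\in\mathcal{M}\}$ (ties broken consistently) and, if $2w(s_e)<w(e)$, set $S\gets S-s_e+e$, $S'\gets S'+e$. Return $S$.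
   Formalization: The set function $f$ takes rational values and the parameters $\varepsilon$ and $\tau$ are rational, rather than real. -}

module Defs where

open import Data.Nat using (ℕ; zero; suc)
open import Data.Bool using (Bool; true; false; if_then_else_)
open import Data.Fin using (Fin; zero; suc)
open import Data.Fin.Subset using (Subset; ⁅_⁆; _∪_; _∩_; _─_; _⊆_; _∈_; _∉_; ∣_∣; ⊥)
open import Data.Vec using ([]; _∷_)
open import Data.Integer using (+_)
open import Data.Rational using (ℚ; 0ℚ; _+_; _-_; _*_; _≤_; _<_; _/_)
open import Data.List using (List; []; _∷_)
open import Data.Product using (Σ; _×_; ∃; _,_)
open import Relation.Binary.PropositionalEquality using (_≡_)
open import Relation.Nullary using (¬_)

Normalized : ∀ {n} → (Subset n → ℚ) → Set
Normalized f = f ⊥ ≡ 0ℚ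

NonNegative : ∀ {n} → (Subset n → ℚ) → Set
NonNegative {n} f = ∀ (X : Subset n) → 0ℚ ≤ f X

Monotone : ∀ {n} → (Subset n → ℚ) → Set
Monotone {n} f = ∀ (X Y : Subset n) → X ⊆ Y → f X ≤ f Y

Submodular : ∀ {n} → (Subset n → ℚ) → Set
Submodular {n} f = ∀ (X Y : Subset n) → f (X ∪ Y) + f (X ∩ Y) ≤ f X + f Y

gain : ∀ {n} → (Subset n → ℚ) → Fin n → Subset n → ℚ
gain f e Y = f (⁅ e ⁆ ∪ Y) - f Y

record Matroid (n : ℕ) : Set₁ where
  field
    Indep    : Subset n → Set
    indep-⊥  : Indep ⊥
    indep-⊆  : ∀ (A B : Subset n) → A ⊆ B → Indep B → Indep A
    augment  : ∀ (A B : Subset n) → Indep A → Indep B → Data.Nat._<_ ∣ A ∣ ∣ B ∣ →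
               ∃ λ x → x ∈ B × x ∉ A × Indep (⁅ x ⁆ ∪ A)
open Matroid public

HasRank : ∀ {n} → Matroid n → ℕ → Set
HasRank {n} M k = (∃ λ (A : Subset n) → Indep M A × ∣ A ∣ ≡ k)
                × (∀ (A : Subset n) → Indep M A → Data.Nat._≤_ ∣ A ∣ k)

wsum : ∀ {n} → (Fin n → ℚ) → Subset n → ℚ
wsum {zero}  w []      = 0ℚ
wsum {suc n} w (b ∷ X) = (if b then w zero else 0ℚ) + wsum (λ i → w (suc i)) X

open import Data.Fin using (_≟_)
open import Relation.Nullary using (yes; no)
upd : ∀ {n} → (Fin n → ℚ) → Fin n → ℚ → (Fin n → ℚ)
upd w e v x with x ≟ e
... | yes _ = v
... | no  _ = w x

ℕtoℚ : ℕ → ℚ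
ℕtoℚ m = + m / 1

record State (n : ℕ) : Set where
  constructor st
  field
    Sset  : Subset n
    S'set : Subset n
    wt    : Fin n → ℚ

-- The threshold test w(e) < (ε/k) τ is written as k · w(e) < ε · τ.
-- Ties in the argmin are broken arbitrarily (every choice is a valid run).
data Step {n : ℕ} (f : Subset n → ℚ) (M : Matroid n) (k : ℕ) (ε τ : ℚ)
     : State n → Fin n → State n → Set where
  ignore : ∀ {S S' w e} →
    ℕtoℚ k * gain f e S' < ε * τ →
    Step f M k ε τ (st S S' w) e (st S S' (upd w e (gain f e S')))
  add : ∀ {S S' w e} →
    ε * τ ≤ ℕtoℚ k * gain f e S' →
    Indep M (⁅ e ⁆ ∪ S) →
    Step f M k ε τ (st S S' w) e (st (⁅ e ⁆ ∪ S) (⁅ e ⁆ ∪ S') (upd w e (gain f e S')))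
  no-candidate : ∀ {S S' w e} →
    ε * τ ≤ ℕtoℚ k * gain f e S' →
    ¬ Indep M (⁅ e ⁆ ∪ S) →
    (∀ y → y ∈ S → ¬ Indep M (⁅ e ⁆ ∪ (S ─ ⁅ y ⁆))) →
    Step f M k ε τ (st S S' w) e (st S S' (upd w e (gain f e S')))
  swap : ∀ {S S' w e} (y : Fin n) →
    ε * τ ≤ ℕtoℚ k * gain f e S' →
    ¬ Indep M (⁅ e ⁆ ∪ S) →
    y ∈ S → Indep M (⁅ e ⁆ ∪ (S ─ ⁅ y ⁆)) →
    (∀ z → z ∈ S → Indep M (⁅ e ⁆ ∪ (S ─ ⁅ z ⁆)) → w y ≤ w z) →
    ℕtoℚ 2 * w y < gain f e S' →
    Step f M k ε τ (st S S' w) e (st (⁅ e ⁆ ∪ (S ─ ⁅ y ⁆)) (⁅ e ⁆ ∪ S') (upd w e (gain f e S')))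
  no-swap : ∀ {S S' w e} (y : Fin n) →
    ε * τ ≤ ℕtoℚ k * gain f e S' →
    ¬ Indep M (⁅ e ⁆ ∪ S) →
    y ∈ S → Indep M (⁅ e ⁆ ∪ (S ─ ⁅ y ⁆)) →
    (∀ z → z ∈ S → Indep M (⁅ e ⁆ ∪ (S ─ ⁅ z ⁆)) → w y ≤ w z) →
    ¬ (ℕtoℚ 2 * w y < gain f e S') →
    Step f M k ε τ (st S S' w) e (st S S' (upd w e (gain f e S')))

data Run {n : ℕ} (f : Subset n → ℚ) (M : Matroid n) (k : ℕ) (ε τ : ℚ)
     : State n → List (Fin n) → State n → Set where
  done : ∀ {σ} → Run f M k ε τ σ [] σ
  step : ∀ {σ σ₁ σ₂ e es} → Step f M k ε τ σ e σ₁ → Run f M k ε τ σ₁ es σ₂ →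
         Run f M k ε τ σ (e ∷ es) σ₂

-- initial state: S = S' = ∅ (weights of not-yet-arrived elements are irrelevant; set to 0)
initState : ∀ {n} → State n
initState = st ⊥ ⊥ (λ _ → 0ℚ)

{-# OPTIONS --safe #-}
module Submission where

open import Defs
open import Data.Nat using (ℕ)
open import Data.Fin using (Fin; zero; suc; _≟_)
open import Data.Fin.Subset using (Subset; _─_; _∪_; _∩_; ⁅_⁆; _∈_; _∉_; _⊆_; ⊥; inside; outside)
open import Data.Fin.Subset.Properties
  using (∉⊥; x∈⁅x⁆; x∈⁅y⁆⇒x≡y; x∉⁅y⁆⇒x≢y; x∈p∪q⁻; x∈p∪q⁺; q⊆p∪q; x∈p∩q⁺; p─q⊆p; p─⊥≡p;
         ∪-identityˡ; drop-∷-⊆; _∈?_)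
open import Data.Rational using (ℚ; 0ℚ; _+_; _-_; -_; _*_; _≤_)
open import Data.Rational.Properties
  using (+-identityˡ; +-inverseʳ; +-monoˡ-≤; +-monoʳ-≤; +-mono-≤; ≤-refl; <⇒≤; module ≤-Reasoning)
open import Data.Rational.Solver using (module +-*-Solver)
open import Data.List using (List; []; _∷_)
open import Data.List.Relation.Unary.All as All using (All; _∷_)
open import Data.List.Relation.Unary.AllPairs using (_∷_)
open import Data.List.Relation.Unary.Unique.Propositional using (Unique)
open import Data.Product using (_×_; _,_)
open import Data.Sum using (inj₁; inj₂; map₂)
open import Data.Bool using (if_then_else_)
open import Data.Vec using ([]; _∷_; here; there)
open import Function using (_∘_)
open import Relation.Nullary using (yes; no; contradiction)
open import Relation.Binary.PropositionalEquality
  using (_≡_; _≢_; refl; sym; trans; cong; cong₂; subst; subst₂; module ≡-Reasoning)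

-- Every accepted element e is weighted by its marginal gain against the current S', so w
-- telescopes and f(S') = w(S') throughout.  For T ⊆ S' + e with e ∈ T, submodularity bounds
-- f(e | S') by f(e | T - e), so w(T) ≤ f(T) holds inductively for every T ⊆ S'.  Finally
-- w(S') ≤ 2 w(S) is preserved: adding e raises both w(S') and w(S) by w(e), while swapping s
-- for e raises w(S') by w(e) and w(S) by w(e) - w(s) > w(e) / 2.  Since S ⊆ S', this bound is
-- w(S' ∖ S) ≤ w(S).  Neither the matroid nor the threshold plays any role.

private
  variable
    n : ℕ
    p q A B T S S' : Subset n
    x e y : Fin n
    w : Fin n → ℚ

p≤q⇒0≤q-p : ∀ {p q} → p ≤ q → 0ℚ ≤ q - p
p≤q⇒0≤q-p {p} {q} p≤q = subst (_≤ q - p) (+-inverseʳ p) (+-monoˡ-≤ (- p) p≤q)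

p-q+q≡p : ∀ p q → (p - q) + q ≡ p
p-q+q≡p = solve 2 (λ p q → (p :- q) :+ q := p) refl
  where open +-*-Solver

p+[q+r]≡q+[p+r] : ∀ p q r → p + (q + r) ≡ q + (p + r)
p+[q+r]≡q+[p+r] = solve 3 (λ p q r → p :+ (q :+ r) := q :+ (p :+ r)) refl
  where open +-*-Solver

+-cancelʳ-≤ : ∀ p q r → p + r ≤ q + r → p ≤ q
+-cancelʳ-≤ p q r h = subst₂ _≤_ (p+r-r≡p p r) (p+r-r≡p q r) (+-monoˡ-≤ (- r) h)
  where
  open +-*-Solver
  p+r-r≡p : ∀ p r → (p + r) - r ≡ p
  p+r-r≡p = solve 2 (λ p r → (p :+ r) :- r := p) refl

p+s≤r+q⇒p-q≤r-s : ∀ p q r s → p + s ≤ r + q → p - q ≤ r - s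
p+s≤r+q⇒p-q≤r-s p q r s h = subst₂ _≤_ left right (+-monoˡ-≤ (- q - s) h)
  where
  open +-*-Solver
  left : (p + s) + (- q - s) ≡ p - q
  left = solve 3 (λ p q s → (p :+ s) :+ ((:- q) :- s) := p :- q) refl p q s
  right : (r + q) + (- q - s) ≡ r - s
  right = solve 3 (λ r q s → (r :+ q) :+ ((:- q) :- s) := r :- s) refl r q s

2*p≡p+p : ∀ p → ℕtoℚ 2 * p ≡ p + p
2*p≡p+p = solve 1 (λ p → con (ℕtoℚ 2) :* p := p :+ p) refl
  where open +-*-Solver

≤-double-exchange : ∀ {g a y r} → y + y ≤ g → a ≤ (y + r) + (y + r) → g + a ≤ (g + r) + (g + r)
≤-double-exchange {g} {a} {y} {r} 2y≤g a≤2[y+r] = begin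
  g + a                     ≤⟨ +-monoʳ-≤ g a≤2[y+r] ⟩
  g + ((y + r) + (y + r))   ≡⟨ regroupˡ g y r ⟩
  (y + y) + (g + (r + r))   ≤⟨ +-monoˡ-≤ (g + (r + r)) 2y≤g ⟩
  g + (g + (r + r))         ≡⟨ regroupʳ g r ⟩
  (g + r) + (g + r)         ∎
  where
  open ≤-Reasoning
  open +-*-Solver
  regroupˡ : ∀ g y r → g + ((y + r) + (y + r)) ≡ (y + y) + (g + (r + r))
  regroupˡ = solve 3 (λ g y r → g :+ ((y :+ r) :+ (y :+ r)) := (y :+ y) :+ (g :+ (r :+ r))) refl
  regroupʳ : ∀ g r → g + (g + (r + r)) ≡ (g + r) + (g + r)
  regroupʳ = solve 2 (λ g r → g :+ (g :+ (r :+ r)) := (g :+ r) :+ (g :+ r)) refl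

≤-double-insert : ∀ {g a r} → 0ℚ ≤ g → a ≤ r + r → g + a ≤ (g + r) + (g + r)
≤-double-insert {a = a} {r} 0≤g a≤2r =
  ≤-double-exchange {y = 0ℚ} 0≤g (subst (λ s → a ≤ s + s) (sym (+-identityˡ r)) a≤2r)

∈-insert⁻ : x ∈ ⁅ e ⁆ ∪ p → x ≢ e → x ∈ p
∈-insert⁻ {e = e} {p = p} x∈e∪p x≢e with x∈p∪q⁻ ⁅ e ⁆ p x∈e∪p
... | inj₁ x∈⁅e⁆ = contradiction (x∈⁅y⁆⇒x≡y e x∈⁅e⁆) x≢e
... | inj₂ x∈p   = x∈p

∉-insert : x ≢ e → x ∉ p → x ∉ ⁅ e ⁆ ∪ p
∉-insert x≢e x∉p x∈e∪p = x∉p (∈-insert⁻ x∈e∪p x≢e)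

x∈p─q⇒x∉q : ∀ (p q : Subset n) → x ∈ p ─ q → x ∉ q
x∈p─q⇒x∉q (_ ∷ p) (outside ∷ q) here        ()
x∈p─q⇒x∉q (_ ∷ p) (outside ∷ q) (there x∈) (there x∈q) = x∈p─q⇒x∉q p q x∈ x∈q
x∈p─q⇒x∉q (_ ∷ p) (inside  ∷ q) (there x∈) (there x∈q) = x∈p─q⇒x∉q p q x∈ x∈q

x∉p─⁅x⁆ : ∀ (p : Subset n) → x ∉ p ─ ⁅ x ⁆
x∉p─⁅x⁆ {x = x} p x∈ = x∈p─q⇒x∉q p ⁅ x ⁆ x∈ (x∈⁅x⁆ x)

∪-monoʳ-⊆ : p ⊆ q → A ∪ p ⊆ A ∪ q
∪-monoʳ-⊆ {p = p} {A = A} p⊆q x∈ = x∈p∪q⁺ (map₂ p⊆q (x∈p∪q⁻ A p x∈))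

⊆-insert⇒⊆ : T ⊆ ⁅ e ⁆ ∪ S → e ∉ T → T ⊆ S
⊆-insert⇒⊆ {T = T} T⊆e∪S e∉T x∈T = ∈-insert⁻ (T⊆e∪S x∈T) λ x≡e → e∉T (subst (_∈ T) x≡e x∈T)

⊆-insert⇒─⊆ : T ⊆ ⁅ e ⁆ ∪ S → T ─ ⁅ e ⁆ ⊆ S
⊆-insert⇒─⊆ {T = T} {e = e} T⊆e∪S x∈ =
  ∈-insert⁻ (T⊆e∪S (p─q⊆p T ⁅ e ⁆ x∈)) (x∉⁅y⁆⇒x≢y (x∈p─q⇒x∉q T ⁅ e ⁆ x∈))

insert-─-⊆ : x ∈ p → ⁅ x ⁆ ∪ (p ─ ⁅ x ⁆) ⊆ p
insert-─-⊆ {x = x} {p = p} x∈p z∈ with x∈p∪q⁻ ⁅ x ⁆ (p ─ ⁅ x ⁆) z∈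
... | inj₁ z∈⁅x⁆ = subst (_∈ p) (sym (x∈⁅y⁆⇒x≡y x z∈⁅x⁆)) x∈p
... | inj₂ z∈p─x = p─q⊆p p ⁅ x ⁆ z∈p─x

wsum-cong : ∀ {w v : Fin n → ℚ} (T : Subset n) → (∀ {x} → x ∈ T → w x ≡ v x) → wsum w T ≡ wsum v T
wsum-cong []            _ = refl
wsum-cong (inside  ∷ T) w≗v = cong₂ _+_ (w≗v here) (wsum-cong T (w≗v ∘ there))
wsum-cong (outside ∷ T) w≗v = cong (0ℚ +_) (wsum-cong T (w≗v ∘ there))

wsum-0 : ∀ (T : Subset n) → wsum (λ _ → 0ℚ) T ≡ 0ℚ
wsum-0 []            = refl
wsum-0 (inside  ∷ T) = trans (+-identityˡ _) (wsum-0 T)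
wsum-0 (outside ∷ T) = trans (+-identityˡ _) (wsum-0 T)

wsum-insert : ∀ (w : Fin n → ℚ) (T : Subset n) → x ∉ T → wsum w (⁅ x ⁆ ∪ T) ≡ w x + wsum w T
wsum-insert {x = zero}  w (inside  ∷ T) x∉T = contradiction here x∉T
wsum-insert {x = zero}  w (outside ∷ T) _   =
  cong (w zero +_) (trans (cong (wsum (w ∘ suc)) (∪-identityˡ T)) (sym (+-identityˡ _)))
wsum-insert {x = suc x} w (b ∷ T) x∉T =
  trans (cong (w₀ +_) (wsum-insert (w ∘ suc) T (x∉T ∘ there))) (p+[q+r]≡q+[p+r] w₀ (w (suc x)) _)
  where w₀ = if b then w zero else 0ℚ

wsum-remove : ∀ (w : Fin n → ℚ) (T : Subset n) → x ∈ T → wsum w T ≡ w x + wsum w (T ─ ⁅ x ⁆)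
wsum-remove w (inside ∷ T) here =
  cong (w zero +_) (trans (cong (wsum (w ∘ suc)) (sym (p─⊥≡p T))) (sym (+-identityˡ _)))
wsum-remove {x = suc x} w (b ∷ T) (there x∈T) =
  trans (cong (w₀ +_) (wsum-remove (w ∘ suc) T x∈T)) (p+[q+r]≡q+[p+r] w₀ (w (suc x)) _)
  where w₀ = if b then w zero else 0ℚ

wsum-─ : ∀ (w : Fin n → ℚ) (p q : Subset n) → q ⊆ p → wsum w (p ─ q) + wsum w q ≡ wsum w p
wsum-─ w []            []            _   = refl
wsum-─ w (outside ∷ p) (inside  ∷ q) q⊆p = contradiction (q⊆p here) λ ()
wsum-─ w (inside  ∷ p) (inside  ∷ q) q⊆p = begin
  (0ℚ + wsum w₊ (p ─ q)) + (w zero + wsum w₊ q) ≡⟨ regroup (wsum w₊ (p ─ q)) (w zero) (wsum w₊ q) ⟩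
  w zero + (wsum w₊ (p ─ q) + wsum w₊ q)        ≡⟨ cong (w zero +_) (wsum-─ w₊ p q (drop-∷-⊆ q⊆p)) ⟩
  w zero + wsum w₊ p                            ∎
  where
  open ≡-Reasoning
  open +-*-Solver
  w₊ = w ∘ suc
  regroup : ∀ a b c → (0ℚ + a) + (b + c) ≡ b + (a + c)
  regroup = solve 3 (λ a b c → (con 0ℚ :+ a) :+ (b :+ c) := b :+ (a :+ c)) refl
wsum-─ w (b ∷ p) (outside ∷ q) q⊆p = begin
  (w₀ + wsum w₊ (p ─ q)) + (0ℚ + wsum w₊ q) ≡⟨ regroup w₀ (wsum w₊ (p ─ q)) (wsum w₊ q) ⟩
  w₀ + (wsum w₊ (p ─ q) + wsum w₊ q)        ≡⟨ cong (w₀ +_) (wsum-─ w₊ p q (drop-∷-⊆ q⊆p)) ⟩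
  w₀ + wsum w₊ p                            ∎
  where
  open ≡-Reasoning
  open +-*-Solver
  w₀ = if b then w zero else 0ℚ
  w₊ = w ∘ suc
  regroup : ∀ a b c → (a + b) + (0ℚ + c) ≡ a + (b + c)
  regroup = solve 3 (λ a b c → (a :+ b) :+ (con 0ℚ :+ c) := a :+ (b :+ c)) refl

upd-≡ : ∀ (w : Fin n → ℚ) e v → upd w e v e ≡ v
upd-≡ w e v with e ≟ e
... | yes _   = refl
... | no  e≢e = contradiction refl e≢e

upd-≢ : ∀ (w : Fin n → ℚ) e v → x ≢ e → upd w e v x ≡ w x
upd-≢ {x = x} w e v x≢e with x ≟ e
... | yes x≡e = contradiction x≡e x≢e
... | no  _   = refl

wsum-upd-∉ : ∀ (w : Fin n → ℚ) v (T : Subset n) → e ∉ T → wsum (upd w e v) T ≡ wsum w T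
wsum-upd-∉ {e = e} w v T e∉T = wsum-cong T λ x∈T → upd-≢ w e v λ x≡e → e∉T (subst (_∈ T) x≡e x∈T)

wsum-upd-insert : ∀ (w : Fin n → ℚ) v (T : Subset n) → e ∉ T →
                  wsum (upd w e v) (⁅ e ⁆ ∪ T) ≡ v + wsum w T
wsum-upd-insert {e = e} w v T e∉T =
  trans (wsum-insert (upd w e v) T e∉T) (cong₂ _+_ (upd-≡ w e v) (wsum-upd-∉ w v T e∉T))

module _ {f : Subset n → ℚ} (mono : Monotone f) where

  gain-nonneg : ∀ e A → 0ℚ ≤ gain f e A
  gain-nonneg e A = p≤q⇒0≤q-p (mono A (⁅ e ⁆ ∪ A) (q⊆p∪q ⁅ e ⁆ A))

  gain-antitone : Submodular f → ∀ e → A ⊆ B → gain f e B ≤ gain f e A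
  gain-antitone {A = A} {B = B} smod e A⊆B =
    p+s≤r+q⇒p-q≤r-s (f (⁅ e ⁆ ∪ B)) (f B) (f (⁅ e ⁆ ∪ A)) (f A) (begin
      f (⁅ e ⁆ ∪ B) + f A     ≤⟨ +-mono-≤ (mono _ _ e∪B⊆X∪B) (mono _ _ A⊆X∩B) ⟩
      f (X ∪ B) + f (X ∩ B)   ≤⟨ smod X B ⟩
      f X + f B               ∎)
    where
    open ≤-Reasoning
    X = ⁅ e ⁆ ∪ A
    e∪B⊆X∪B : ⁅ e ⁆ ∪ B ⊆ X ∪ B
    e∪B⊆X∪B {x} x∈ with x∈p∪q⁻ ⁅ e ⁆ B x∈
    ... | inj₁ x∈⁅e⁆ = x∈p∪q⁺ (inj₁ (x∈p∪q⁺ (inj₁ x∈⁅e⁆)))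
    ... | inj₂ x∈B   = x∈p∪q⁺ (inj₂ x∈B)
    A⊆X∩B : A ⊆ X ∩ B
    A⊆X∩B x∈A = x∈p∩q⁺ (q⊆p∪q ⁅ e ⁆ A x∈A , A⊆B x∈A)

gain+f≡f-insert : ∀ (f : Subset n → ℚ) e A → gain f e A + f A ≡ f (⁅ e ⁆ ∪ A)
gain+f≡f-insert f e A = p-q+q≡p (f (⁅ e ⁆ ∪ A)) (f A)

record ModularLowerBound (f : Subset n → ℚ) (S : Subset n) (w : Fin n → ℚ) : Set where
  field
    tight : f S ≡ wsum w S
    below : ∀ T → T ⊆ S → wsum w T ≤ f T

open ModularLowerBound

module _ {f : Subset n → ℚ} where

  modularLowerBound-⊥ : NonNegative f → Normalized f → ModularLowerBound f ⊥ (λ _ → 0ℚ)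
  modularLowerBound-⊥ nonneg normalized .tight = trans normalized (sym (wsum-0 {n} ⊥))
  modularLowerBound-⊥ nonneg normalized .below T _ = subst (_≤ f T) (sym (wsum-0 T)) (nonneg T)

  modularLowerBound-upd : ∀ v → e ∉ S → ModularLowerBound f S w → ModularLowerBound f S (upd w e v)
  modularLowerBound-upd {S = S} {w = w} v e∉S lb .tight = trans (tight lb) (sym (wsum-upd-∉ w v S e∉S))
  modularLowerBound-upd {e = e} {w = w} v e∉S lb .below T T⊆S =
    subst (_≤ f T) (sym (wsum-upd-∉ w v T (e∉S ∘ T⊆S))) (below lb T T⊆S)

  modularLowerBound-insert : Monotone f → Submodular f → e ∉ S → ModularLowerBound f S w →
                             ModularLowerBound f (⁅ e ⁆ ∪ S) (upd w e (gain f e S))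
  modularLowerBound-insert {e = e} {S = S} {w = w} mono smod e∉S lb =
    record { tight = tight′ ; below = below′ }
    where
    g = gain f e S
    w′ = upd w e g
    open ≤-Reasoning

    tight′ : f (⁅ e ⁆ ∪ S) ≡ wsum w′ (⁅ e ⁆ ∪ S)
    tight′ = begin-equality
      f (⁅ e ⁆ ∪ S)   ≡⟨ gain+f≡f-insert f e S ⟨
      g + f S         ≡⟨ cong (g +_) (tight lb) ⟩
      g + wsum w S    ≡⟨ wsum-upd-insert w g S e∉S ⟨
      wsum w′ (⁅ e ⁆ ∪ S) ∎

    below′ : ∀ T → T ⊆ ⁅ e ⁆ ∪ S → wsum w′ T ≤ f T
    below′ T T⊆e∪S with e ∈? T
    ... | no e∉T = below (modularLowerBound-upd g e∉S lb) T (⊆-insert⇒⊆ T⊆e∪S e∉T)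
    ... | yes e∈T = begin
      wsum w′ T                   ≡⟨ wsum-remove w′ T e∈T ⟩
      w′ e + wsum w′ U            ≡⟨ cong₂ _+_ (upd-≡ w e g) (wsum-upd-∉ w g U (x∉p─⁅x⁆ T)) ⟩
      g + wsum w U                ≤⟨ +-monoʳ-≤ g (below lb U U⊆S) ⟩
      g + f U                     ≤⟨ +-monoˡ-≤ (f U) (gain-antitone mono smod e U⊆S) ⟩
      gain f e U + f U            ≡⟨ gain+f≡f-insert f e U ⟩
      f (⁅ e ⁆ ∪ U)               ≤⟨ mono _ _ (insert-─-⊆ e∈T) ⟩
      f T                         ∎
      where
      U = T ─ ⁅ e ⁆
      U⊆S : U ⊆ S
      U⊆S = ⊆-insert⇒─⊆ T⊆e∪S

wsum-double-bound-insert : ∀ (w : Fin n → ℚ) v → e ∉ S' → S ⊆ S' → 0ℚ ≤ v →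
                     wsum w S' ≤ wsum w S + wsum w S →
                     let w′ = upd w e v; S₁ = ⁅ e ⁆ ∪ S in
                     wsum w′ (⁅ e ⁆ ∪ S') ≤ wsum w′ S₁ + wsum w′ S₁
wsum-double-bound-insert {S' = S'} {S = S} w v e∉S' S⊆S' 0≤v S'≤2S =
  subst₂ _≤_ (sym (wsum-upd-insert w v S' e∉S')) (sym (cong₂ _+_ S-grows S-grows))
         (≤-double-insert 0≤v S'≤2S)
  where
  S-grows = wsum-upd-insert w v S (e∉S' ∘ S⊆S')

wsum-double-bound-exchange : ∀ (w : Fin n → ℚ) v → e ∉ S' → S ⊆ S' → y ∈ S → w y + w y ≤ v →
                       wsum w S' ≤ wsum w S + wsum w S →
                       let w′ = upd w e v; S₁ = ⁅ e ⁆ ∪ (S ─ ⁅ y ⁆) in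
                       wsum w′ (⁅ e ⁆ ∪ S') ≤ wsum w′ S₁ + wsum w′ S₁
wsum-double-bound-exchange {S' = S'} {S = S} {y = y} w v e∉S' S⊆S' y∈S 2wy≤v S'≤2S =
  subst₂ _≤_ (sym (wsum-upd-insert w v S' e∉S')) (sym (cong₂ _+_ S-grows S-grows))
         (≤-double-exchange {y = w y} 2wy≤v (subst (λ s → _ ≤ s + s) (wsum-remove w S y∈S) S'≤2S))
  where
  S-grows = wsum-upd-insert w v (S ─ ⁅ y ⁆) (e∉S' ∘ S⊆S' ∘ p─q⊆p S ⁅ y ⁆)

record Invariant (f : Subset n → ℚ) (σ : State n) (pending : List (Fin n)) : Set where
  open State σ
  field
    S⊆S′        : Sset ⊆ S'set
    pending-∉   : All (_∉ S'set) pending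
    lowerBound  : ModularLowerBound f S'set wt
    S′≤2S       : wsum wt S'set ≤ wsum wt Sset + wsum wt Sset

module _ {f : Subset n → ℚ} (mono : Monotone f) (smod : Submodular f) where

  reweigh : ∀ {es} v → Invariant f (st S S' w) (e ∷ es) → Invariant f (st S S' (upd w e v)) es
  reweigh {S = S} {S' = S'} {w = w} v I = record
    { S⊆S′       = S⊆S′
    ; pending-∉  = All.tail pending-∉
    ; lowerBound = modularLowerBound-upd v e∉S' lowerBound
    ; S′≤2S      = subst₂ _≤_ (sym (wsum-upd-∉ w v S' e∉S')) (sym (cong₂ _+_ S-unchanged S-unchanged))
                              S′≤2S
    }
    where
    open Invariant I
    e∉S' = All.head pending-∉
    S-unchanged = wsum-upd-∉ w v S (e∉S' ∘ S⊆S′)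

  accept : ∀ {es} S₁ → Invariant f (st S S' w) (e ∷ es) → All (e ≢_) es → S₁ ⊆ ⁅ e ⁆ ∪ S' →
           let w′ = upd w e (gain f e S') in
           wsum w′ (⁅ e ⁆ ∪ S') ≤ wsum w′ S₁ + wsum w′ S₁ → Invariant f (st S₁ (⁅ e ⁆ ∪ S') w′) es
  accept S₁ I fresh S₁⊆ bound = record
    { S⊆S′       = S₁⊆
    ; pending-∉  = All.zipWith (λ (e≢x , x∉S') → ∉-insert (e≢x ∘ sym) x∉S') (fresh , All.tail pending-∉)
    ; lowerBound = modularLowerBound-insert mono smod (All.head pending-∉) lowerBound
    ; S′≤2S      = bound
    }
    where open Invariant I

  step-preserves : ∀ {M k ε τ σ σ₁ es} → Invariant f σ (e ∷ es) → All (e ≢_) es →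
                   Step f M k ε τ σ e σ₁ → Invariant f σ₁ es
  step-preserves I _ (ignore _)                  = reweigh _ I
  step-preserves I _ (no-candidate _ _ _)        = reweigh _ I
  step-preserves I _ (no-swap _ _ _ _ _ _ _)     = reweigh _ I
  step-preserves {e = e} {σ = st S S' w} I fresh (add _ _) =
    accept (⁅ e ⁆ ∪ S) I fresh (∪-monoʳ-⊆ S⊆S′)
      (wsum-double-bound-insert w _ (All.head pending-∉) S⊆S′ (gain-nonneg mono e S') S′≤2S)
    where open Invariant I
  step-preserves {e = e} {σ = st S S' w} I fresh (swap y _ _ y∈S _ _ 2wy<g) =
    accept (⁅ e ⁆ ∪ (S ─ ⁅ y ⁆)) I fresh (∪-monoʳ-⊆ (S⊆S′ ∘ p─q⊆p S ⁅ y ⁆))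
      (wsum-double-bound-exchange w _ (All.head pending-∉) S⊆S′ y∈S 2wy≤g S′≤2S)
    where
    open Invariant I
    2wy≤g = subst (_≤ gain f e S') (2*p≡p+p (w y)) (<⇒≤ 2wy<g)

  run-preserves : ∀ {M k ε τ σ σ₁ es} → Unique es → Invariant f σ es →
                  Run f M k ε τ σ es σ₁ → Invariant f σ₁ []
  run-preserves _                I done       = I
  run-preserves (fresh ∷ unique) I (step s r) = run-preserves unique (step-preserves I fresh s) r

invariant-init : ∀ {f : Subset n → ℚ} → NonNegative f → Normalized f → ∀ es → Invariant f initState es
invariant-init {n} nonneg normalized es = record
  { S⊆S′       = λ x∈⊥ → x∈⊥
  ; pending-∉  = All.universal (λ _ → ∉⊥) es
  ; lowerBound = modularLowerBound-⊥ nonneg normalized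
  ; S′≤2S      = subst₂ _≤_ (sym (wsum-0 {n} ⊥)) (sym (cong₂ _+_ (wsum-0 {n} ⊥) (wsum-0 {n} ⊥))) ≤-refl
  }

wsum-─-≤ : ∀ (w : Fin n → ℚ) → S ⊆ S' → wsum w S' ≤ wsum w S + wsum w S → wsum w (S' ─ S) ≤ wsum w S
wsum-─-≤ {S = S} {S' = S'} w S⊆S' S'≤2S =
  +-cancelʳ-≤ _ _ (wsum w S) (subst (_≤ wsum w S + wsum w S) (sym (wsum-─ w S' S S⊆S')) S'≤2S)

lemma16 : ∀ {n : ℕ} (f : Subset n → ℚ) → NonNegative f → Normalized f → Monotone f → Submodular f →
          (M : Matroid n) (k : ℕ) → HasRank M k →
          (ε τ : ℚ) → 0ℚ ≤ ε → 0ℚ ≤ τ →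
          (stream : List (Fin n)) → Unique stream →
          (S S' : Subset n) (w : Fin n → ℚ) →
          Run f M k ε τ initState stream (st S S' w) →
          (wsum w (S' ─ S) ≤ wsum w S) × (wsum w S ≤ f S) × (f S' ≡ wsum w S')
lemma16 f nonneg normalized mono smod _ _ _ _ _ _ _ stream unique S S' w run =
  wsum-─-≤ w S⊆S′ S′≤2S , below lowerBound S S⊆S′ , tight lowerBound
  where open Invariant (run-preserves mono smod unique (invariant-init nonneg normalized stream) run)
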